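{- Let $3 \le p \le q$ and let $D$ be a strong orientation of $K(3,p,q)$ with parts $V_1=\{x_1,x_2,x_3\}$, $V_2$ ($|V_2|=p$), $V_3$ ($|V_3|=q$). If $V_2 = V_2^{[3]}$ or $V_2 = V_2^{\emptyset}$, then $\mathrm{diam}(D) \ge 3$.
   Context: $K(3,p,q)$ is the complete tripartite graph with parts $V_1=\{x_1,x_2,x_3\}$, $V_2$ of size $p$, $V_3$ of size $q$. A strong orientation is an orientation of all edges making the digraph strongly connected; $\mathrm{diam}(D)$ is the maximum directed distance between ordered pairs of vertices. Write $u\to v$ if the edge $uv$ is oriented from $u$ to $v$. For $A \subseteq [3]=\{1,2,3\}$, let $N_D^A$ be the set of vertices $w$ such that $x_i \to w$ for all $i \in A$ and $w \to x_j$ for all $j \in [3]\setminus A$, and $V_2^A = V_2 \cap N_D^A$. Thus $V_2^{[3]}$ is the set of vertices of $V_2$ that are out-neighbours of all of $x_1,x_2,x_3$, and $V_2^{\emptyset}$ the set of vertices of $V_2$ that are in-neighbours of all of $x_1,x_2,x_3$. -}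

module Defs where

open import Data.Nat using (ℕ; zero; suc; _≤_)
open import Data.Fin using (Fin)
open import Data.Sum using (_⊎_; inj₁; inj₂)
open import Data.Product using (Σ; ∃; ∃-syntax; _×_; _,_)
open import Data.Empty using (⊥)
open import Data.Unit using (⊤)
open import Relation.Nullary using (¬_)

-- Vertex set of K(3,p,q): part V₁ = Fin 3 (x₁,x₂,x₃), V₂ = Fin p, V₃ = Fin q.
Vertex : ℕ → ℕ → Set
Vertex p q = Fin 3 ⊎ (Fin p ⊎ Fin q)

part : ∀ {p q} → Vertex p q → Fin 3
part (inj₁ _) = Fin.zero
part (inj₂ (inj₁ _)) = Fin.suc Fin.zero
part (inj₂ (inj₂ _)) = Fin.suc (Fin.suc Fin.zero)

Adjacent : ∀ {p q} → Vertex p q → Vertex p q → Set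
Adjacent u v = ¬ (part u ≡ part v)
  where open import Relation.Binary.PropositionalEquality using (_≡_)

record Orientation (p q : ℕ) : Set₁ where
  field
    _⟶_      : Vertex p q → Vertex p q → Set
    arc-adj  : ∀ {u v} → u ⟶ v → Adjacent u v
    total    : ∀ u v → Adjacent u v → (u ⟶ v) ⊎ (v ⟶ u)
    antisym  : ∀ {u v} → u ⟶ v → v ⟶ u → ⊥

open Orientation public

data Walk {p q} (D : Orientation p q) : ℕ → Vertex p q → Vertex p q → Set where
  here : ∀ {u} → Walk D zero u u
  step : ∀ {k u w v} → _⟶_ D u w → Walk D k w v → Walk D (suc k) u v

DistLe : ∀ {p q} → Orientation p q → ℕ → Vertex p q → Vertex p q → Set
DistLe D k u v = ∃[ m ] (m ≤ k × Walk D m u v)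

Strong : ∀ {p q} → Orientation p q → Set
Strong D = ∀ u v → ∃[ k ] Walk D k u v

-- diam(D) ≥ k  iff  some ordered pair has distance ≥ k,
-- i.e. is not at distance ≤ k - 1.  (Finite vertex set, so the max is attained.)
DiamGe : ∀ {p q} → Orientation p q → ℕ → Set
DiamGe D zero = ⊤
DiamGe D (suc k) = ∃[ u ] ∃[ v ] ¬ DistLe D k u v

x : ∀ {p q} → Fin 3 → Vertex p q
x i = inj₁ i

v₂ : ∀ {p q} → Fin p → Vertex p q
v₂ w = inj₂ (inj₁ w)

-- V₂ = V₂^[3]: every vertex of V₂ is an out-neighbour of x₁, x₂, x₃
AllV2Out : ∀ {p q} → Orientation p q → Set
AllV2Out {p} D = ∀ (w : Fin p) (i : Fin 3) → _⟶_ D (x i) (v₂ w)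

-- V₂ = V₂^∅: every vertex of V₂ is an in-neighbour of x₁, x₂, x₃
AllV2In : ∀ {p q} → Orientation p q → Set
AllV2In {p} D = ∀ (w : Fin p) (i : Fin 3) → _⟶_ D (v₂ w) (x i)

-- If V₂ = V₂^[3], take x₁. Should x₁ have an out-neighbour z ∈ V₃, a walk z → w → x₁ would need
-- w ∈ V₂, but no arc leaves V₂ towards V₁; so d(z, x₁) ≥ 3. Otherwise every out-neighbour of x₁
-- lies in V₂ and the same obstruction gives d(x₁, x₂) ≥ 3. The case V₂ = V₂^∅ is the first one
-- for the reversed orientation, which has the same diameter.
{-# OPTIONS --safe #-}
module Submission where

open import Defs
open import Data.Nat using (ℕ; _≤_; zero; suc; s≤s)
open import Data.Sum using (_⊎_; inj₁; inj₂; swap)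
open import Data.Fin using (Fin)
open import Data.Fin.Properties using (any?)
open import Data.Product using (_,_)
open import Function using (flip)
open import Relation.Nullary using (¬_; yes; no; Dec)
open import Relation.Binary.PropositionalEquality using (_≢_; refl; sym)

private
  variable
    p q : ℕ

Adjacent-sym : {u v : Vertex p q} → Adjacent u v → Adjacent v u
Adjacent-sym u≁v eq = u≁v (sym eq)

reverse : Orientation p q → Orientation p q
reverse D = record
  { _⟶_     = flip (_⟶_ D)
  ; arc-adj = λ a → Adjacent-sym (arc-adj D a)
  ; total   = λ u v adj → swap (total D u v adj)
  ; antisym = flip (antisym D)
  }

_∷ʳ_ : ∀ {D : Orientation p q} {k u v w} → Walk D k u v → _⟶_ D v w → Walk D (suc k) u w
here       ∷ʳ b = step b here
step a wlk ∷ʳ b = step a (wlk ∷ʳ b)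

module _ (D : Orientation p q) where

  open Orientation D using () renaming (_⟶_ to _⇒_)

  reverse-walk : ∀ {k u v} → Walk D k u v → Walk (reverse D) k v u
  reverse-walk here         = here
  reverse-walk (step a wlk) = reverse-walk wlk ∷ʳ a

  reverse-DistLe : ∀ {k u v} → DistLe D k u v → DistLe (reverse D) k v u
  reverse-DistLe (m , m≤k , wlk) = m , m≤k , reverse-walk wlk

  reverse-DiamGe : ∀ k → DiamGe (reverse D) k → DiamGe D k
  reverse-DiamGe zero    _             = _
  reverse-DiamGe (suc k) (u , v , far) = v , u , λ d → far (reverse-DistLe d)

  arc? : ∀ u v → Adjacent u v → Dec (u ⇒ v)
  arc? u v adj with total D u v adj
  ... | inj₁ u⇒v = yes u⇒v
  ... | inj₂ v⇒u = no (λ u⇒v → antisym D u⇒v v⇒u)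

  ¬DistLe2 : ∀ {u v} → u ≢ v → ¬ u ⇒ v → (∀ w → u ⇒ w → ¬ w ⇒ v) → ¬ DistLe D 2 u v
  ¬DistLe2 u≢v _    _         (zero , _ , here)                           = u≢v refl
  ¬DistLe2 _   ¬u⇒v _         (suc zero , _ , step a here)                = ¬u⇒v a
  ¬DistLe2 _   _    no-2-walk (suc (suc zero) , _ , step a (step b here)) = no-2-walk _ a b
  ¬DistLe2 _   _    _         (suc (suc (suc _)) , s≤s (s≤s ()) , _)

  v₃ : Fin q → Vertex p q
  v₃ z = inj₂ (inj₂ z)

  module _ (out : AllV2Out D) where

    ¬DistLe2-v₃-x : ∀ i z → x i ⇒ v₃ z → ¬ DistLe D 2 (v₃ z) (x i)
    ¬DistLe2-v₃-x i z x⇒z = ¬DistLe2 (λ ()) (antisym D x⇒z) middle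
      where
      middle : ∀ w → v₃ z ⇒ w → ¬ w ⇒ x i
      middle (inj₁ _)          _   w⇒x = arc-adj D w⇒x refl
      middle (inj₂ (inj₁ w))   _   w⇒x = antisym D (out w i) w⇒x
      middle (inj₂ (inj₂ _))   z⇒w _   = arc-adj D z⇒w refl

    ¬DistLe2-x-x : ∀ i j → i ≢ j → (∀ z → ¬ x i ⇒ v₃ z) → ¬ DistLe D 2 (x i) (x j)
    ¬DistLe2-x-x i j i≢j no-V₃ =
      ¬DistLe2 (λ { refl → i≢j refl }) (λ a → arc-adj D a refl) middle
      where
      middle : ∀ w → x i ⇒ w → ¬ w ⇒ x j
      middle (inj₁ _)          x⇒w _   = arc-adj D x⇒w refl
      middle (inj₂ (inj₁ w))   _   w⇒x = antisym D (out w j) w⇒x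
      middle (inj₂ (inj₂ z))   x⇒z _   = no-V₃ z x⇒z

    AllV2Out⇒diam≥3 : DiamGe D 3
    AllV2Out⇒diam≥3 with any? (λ z → arc? (x Fin.zero) (v₃ z) (λ ()))
    ... | yes (z , x⇒z) = v₃ z , x Fin.zero , ¬DistLe2-v₃-x Fin.zero z x⇒z
    ... | no  ¬x⇒V₃     = x Fin.zero , x (Fin.suc Fin.zero) ,
                           ¬DistLe2-x-x Fin.zero (Fin.suc Fin.zero) (λ ()) (λ z a → ¬x⇒V₃ (z , a))

lemma4p1 : (p q : ℕ) → 3 ≤ p → p ≤ q → (D : Orientation p q) → Strong D →
    (AllV2Out D ⊎ AllV2In D) → DiamGe D 3
lemma4p1 p q _ _ D _ (inj₁ out)  = AllV2Out⇒diam≥3 D out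
lemma4p1 p q _ _ D _ (inj₂ into) = reverse-DiamGe D 3 (AllV2Out⇒diam≥3 (reverse D) into)
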